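{- Let $G=(V,E)$ be a graph whose vertices fail randomly and independently, vertex $v$ with probability $q_v=1-p_v$, and let $\mathbf{p}=(p_v)_{v\in V}\in[0,1]^V$. Then \[\operatorname{DRel}(G,\mathbf{p})=\sum_{J\subseteq V}(-1)^{|J|}\prod_{v\in N_G[J]}q_v.\] Moreover, if $G$ has no isolated vertices, then for any linear ordering of $V$ and any set $\mathscr{X}$ of broken neighbourhoods of $G$ (with respect to this ordering), \[\operatorname{DRel}(G,\mathbf{p})=\sum_{\substack{J\subseteq V\\ J\not\supseteq X\ \forall X\in\mathscr{X}}}(-1)^{|J|}\prod_{v\in N_G[J]}q_v.\]
   Context: All graphs are finite, undirected and simple; edges never fail. A set $X\subseteq V$ is dominating if every vertex in $V\setminus X$ is adjacent to a vertex of $X$; $\operatorname{DRel}(G,\mathbf{p})$ is the probability that the set of operating vertices is dominating. $N_G[J]$ is the closed neighbourhood of $J\subseteq V$ (vertices in $J$ or adjacent to a vertex in $J$), $N_G[v]=N_G[\{v\}]$. Given a linear ordering of $V$, a broken neighbourhood of $G$ is a set $N_G[v]\setminus\{v\}$ for a vertex $v$ with $v=\max N_G[v]$. -}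

module Defs where

open import Level using (Level; 0ℓ)
open import Data.Nat using (ℕ; zero; suc)
open import Data.Bool using (Bool; true; false; if_then_else_; _∨_)
open import Data.Fin using (Fin; zero; suc)
open import Data.Fin.Subset using (Subset; inside; outside; _∈_; _∉_; _⊆_; ∣_∣)
import Data.Fin.Subset as S
open import Data.Fin.Subset.Properties using (_∈?_; _⊆?_)
open import Data.Fin.Properties using (any?; all?)
open import Data.Vec using ([]; _∷_; tabulate)
open import Data.List using (List; []; _∷_; map; _++_; foldr)
open import Data.List.Relation.Unary.All using (All)
import Data.List.Relation.Unary.All as All
open import Data.Product using (Σ; ∃; _×_; _,_)
open import Data.Sum using (_⊎_)
open import Relation.Nullary using (¬_; Dec; does)
open import Relation.Nullary.Decidable using (_→-dec_; ¬?; _×-dec_)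
open import Relation.Binary.PropositionalEquality using (_≡_)
open import Relation.Binary using (Rel; IsStrictTotalOrder)
open import Algebra.Bundles using (CommutativeRing)

record Graph (n : ℕ) : Set where
  field
    adj    : Fin n → Fin n → Bool
    sym    : ∀ u v → adj u v ≡ adj v u
    irrefl : ∀ v → adj v v ≡ false
open Graph public

Adj : ∀ {n} → Graph n → Fin n → Fin n → Set
Adj G u v = adj G u v ≡ true

NoIsolated : ∀ {n} → Graph n → Set
NoIsolated {n} G = ∀ v → ∃ λ u → Adj G v u

allSubsets : (n : ℕ) → List (Subset n)
allSubsets zero    = [] ∷ []
allSubsets (suc n) = map (inside ∷_) (allSubsets n) ++ map (outside ∷_) (allSubsets n)

inN : ∀ {n} → Graph n → Subset n → Fin n → Bool
inN {n} G J v = does (v ∈? J) ∨ does (any? (λ u → u ∈? J ×-dec Data.Bool._≟_ (adj G u v) true))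

N[_]_ : ∀ {n} → Graph n → Subset n → Subset n
N[ G ] J = tabulate (λ v → if inN G J v then inside else outside)

Dominating : ∀ {n} → Graph n → Subset n → Set
Dominating {n} G X = ∀ v → v ∉ X → ∃ λ u → u ∈ X × Adj G u v

dominating? : ∀ {n} (G : Graph n) (X : Subset n) → Dec (Dominating G X)
dominating? G X = all? (λ v → ¬? (v ∈? X) →-dec any? (λ u → u ∈? X ×-dec Data.Bool._≟_ (adj G u v) true))

IsBrokenNbhd : ∀ {n} → Graph n → (_≺_ : Rel (Fin n) 0ℓ) → Subset n → Set
IsBrokenNbhd {n} G _≺_ X =
  ∃ λ v → (∀ u → u ∈ (N[ G ] (Data.Fin.Subset.⁅_⁆ v)) → u ≡ v ⊎ u ≺ v)
        × X ≡ (N[ G ] (Data.Fin.Subset.⁅_⁆ v)) S.- v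

module _ {c ℓ : Level} (R : CommutativeRing c ℓ) where
  open CommutativeRing R using (Carrier; _+_; _*_; -_; 0#; 1#) renaming (_-_ to _−_)

  sumL : {A : Set} → (A → Carrier) → List A → Carrier
  sumL f = foldr (λ a s → f a + s) 0#

  prodFin : ∀ {n} → (Fin n → Carrier) → Carrier
  prodFin {zero}  f = 1#
  prodFin {suc n} f = f zero * prodFin (λ i → f (suc i))

  signPow : ℕ → Carrier
  signPow zero    = 1#
  signPow (suc k) = (- 1#) * signPow k

  qOf : ∀ {n} → (Fin n → Carrier) → Fin n → Carrier
  qOf p v = 1# − p v

  -- Probability that the vertex set X is exactly the set of operating vertices
  -- (independent vertex operation, v operating with probability p v).
  stateProb : ∀ {n} → (Fin n → Carrier) → Subset n → Carrier
  stateProb p X = prodFin (λ v → if does (v ∈? X) then p v else qOf p v)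

  DRel : ∀ {n} → Graph n → (Fin n → Carrier) → Carrier
  DRel {n} G p = sumL (λ X → if does (dominating? G X) then stateProb p X else 0#) (allSubsets n)

  incExcTerm : ∀ {n} → Graph n → (Fin n → Carrier) → Subset n → Carrier
  incExcTerm G p J =
    signPow ∣ J ∣ * prodFin (λ v → if does (v ∈? (N[ G ] J)) then qOf p v else 1#)

  avoids? : ∀ {n} (𝒳 : List (Subset n)) (J : Subset n) → Dec (All (λ X → ¬ (X ⊆ J)) 𝒳)
  avoids? 𝒳 J = All.all? (λ X → ¬? (X ⊆? J)) 𝒳

-- Expanding each product ∏_{v ∈ N[J]} q_v as the probability that every vertex of N[J] fails
-- and exchanging the two sums, the coefficient of the state X becomes
-- ∑_{J ⊆ V ∖ N[X]} (-1)^|J|, which is 1 if X dominates G and 0 otherwise.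
-- For the second formula, order the centres of the broken neighbourhoods decreasingly and
-- remove them one at a time: the terms with N[m] ∖ {m} ⊆ J cancel in pairs J ∪ {m}, J ∖ {m},
-- which have the same closed neighbourhood (m has a neighbour, and all of them lie in J) but
-- sizes of opposite parity; the maximality of m makes this pairing respect the remaining constraints.
module Submission where

open import Defs hiding (sym; irrefl)
open import Level using (Level; 0ℓ)
open import Function using (_∘_; flip; _⇔_; mk⇔; Equivalence)
open import Data.Nat using (ℕ; zero; suc)
open import Data.Bool using (Bool; true; false; if_then_else_; _∧_; not)
import Data.Bool as Bool
open import Data.Fin using (Fin; zero; suc)
import Data.Fin.Properties as Fin
open import Data.Fin.Properties using (any?)
open import Data.Fin.Subset using (Subset; inside; outside; _∈_; _∉_; _⊆_; ∣_∣; ⁅_⁆; ∁; _─_; _-_)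
import Data.Fin.Subset as Subset
open import Data.Fin.Subset.Properties
  using (_∈?_; _⊆?_; ⊆-antisym; x∈⁅x⁆; x∈∁p⇒x∉p; x∉p⇒x∈∁p; x∉∁p⇒x∈p; x∈p∧x≢y⇒x∈p-y; p─q⊆p; ∉⊥)
open import Data.Vec using (_∷_; []; lookup; _[_]≔_; here; there)
open import Data.Vec.Properties using ([]=⇒lookup; lookup⇒[]=; lookup∘tabulate; lookup∘update′; []≔-updates; []≔-minimal)
open import Data.List using (List; []; _∷_; map; _++_)
open import Data.List.Relation.Unary.All using (All; []; _∷_)
import Data.List.Relation.Unary.All as All
import Data.List.Relation.Unary.All.Properties as All
open import Data.List.Relation.Unary.AllPairs using (AllPairs; []; _∷_)
open import Data.List.Relation.Binary.Permutation.Propositional using (_↭_; ↭-sym)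
import Data.List.Relation.Binary.Permutation.Propositional.Properties as ↭
open import Data.List.Relation.Unary.Sorted.TotalOrder.Properties using (Sorted⇒AllPairs)
open import Data.Product using (∃; _×_; _,_; proj₁)
open import Data.Sum using (_⊎_; inj₁; inj₂)
open import Data.Empty using (⊥)
open import Relation.Nullary using (Dec; does; yes; no; contradiction)
open import Relation.Nullary.Decidable using (_⊎-dec_; _×-dec_; ¬?; does-⇔)
open import Relation.Binary using (Rel; IsStrictTotalOrder; DecTotalOrder)
import Relation.Binary.Construct.StrictToNonStrict as NonStrict
import Relation.Binary.Construct.Flip.EqAndOrd as Flip
open import Relation.Binary.PropositionalEquality using (_≡_; _≢_; refl; sym; trans; cong; cong₂)
open import Algebra.Bundles using (CommutativeRing)
import Algebra.Properties.Ring as RingProperties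
import Algebra.Properties.CommutativeSemigroup as CommutativeSemigroupProperties

private
  variable
    n : ℕ
    A B : Set

does≡true⇔ : ∀ {p} {P : Set p} (d : Dec P) → does d ≡ true ⇔ P
does≡true⇔ (yes p) = mk⇔ (λ _ → p) (λ _ → refl)
does≡true⇔ (no ¬p) = mk⇔ (λ ()) (λ p → contradiction p ¬p)

∈⇔lookup : ∀ {x : Fin n} {J : Subset n} → x ∈ J ⇔ lookup J x ≡ inside
∈⇔lookup {x = x} {J = J} = mk⇔ []=⇒lookup (lookup⇒[]= x J)

x∈p─q⇒x∉q : ∀ {x : Fin n} (p q : Subset n) → x ∈ p ─ q → x ∉ q
x∈p─q⇒x∉q (inside ∷ p)  (outside ∷ q) here       ()
x∈p─q⇒x∉q (_ ∷ p)       (_ ∷ q)       (there x∈) (there x∈q) = x∈p─q⇒x∉q p q x∈ x∈q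

x∈p-y⇒x≢y : ∀ {x y : Fin n} (p : Subset n) → x ∈ p - y → x ≢ y
x∈p-y⇒x≢y {y = y} p x∈ refl = x∈p─q⇒x∉q p ⁅ y ⁆ x∈ (x∈⁅x⁆ y)

∈-[]≔⁻ : ∀ {x m : Fin n} {J : Subset n} {s} → x ≢ m → x ∈ J [ m ]≔ s → x ∈ J
∈-[]≔⁻ {x = x} {m} {J} {s} x≢m x∈ = lookup⇒[]= x J (trans (sym (lookup∘update′ x≢m J s)) ([]=⇒lookup x∈))

∈-[]≔⁺ : ∀ {x m : Fin n} {J : Subset n} {s} → x ≢ m → x ∈ J → x ∈ J [ m ]≔ s
∈-[]≔⁺ {x = x} {m} {J} x≢m x∈J = []≔-minimal J x m x≢m x∈J

∉-[]≔outside : ∀ (J : Subset n) m → m ∉ J [ m ]≔ outside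
∉-[]≔outside J m m∈ with () ← trans (sym ([]=⇒lookup m∈)) ([]=⇒lookup ([]≔-updates J m))

[]≔outside⊆[]≔inside : ∀ (J : Subset n) m → J [ m ]≔ outside ⊆ J [ m ]≔ inside
[]≔outside⊆[]≔inside J m {x} x∈ with x Fin.≟ m
... | yes refl = contradiction x∈ (∉-[]≔outside J m)
... | no x≢m   = ∈-[]≔⁺ x≢m (∈-[]≔⁻ x≢m x∈)

∣[]≔inside∣ : ∀ (J : Subset n) m → ∣ J [ m ]≔ inside ∣ ≡ suc ∣ J [ m ]≔ outside ∣
∣[]≔inside∣ (_ ∷ J)       zero    = refl
∣[]≔inside∣ (inside ∷ J)  (suc m) = cong suc (∣[]≔inside∣ J m)
∣[]≔inside∣ (outside ∷ J) (suc m) = ∣[]≔inside∣ J m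

⊆-[]≔⇔ : ∀ {Y J : Subset n} {m s} → m ∉ Y → Y ⊆ J [ m ]≔ s ⇔ Y ⊆ J
⊆-[]≔⇔ {Y = Y} {m = m} m∉Y =
  mk⇔ (λ Y⊆ {y} y∈ → ∈-[]≔⁻ (≢m y∈) (Y⊆ y∈)) (λ Y⊆ {y} y∈ → ∈-[]≔⁺ (≢m y∈) (Y⊆ y∈))
  where
  ≢m : ∀ {y} → y ∈ Y → y ≢ m
  ≢m y∈ refl = m∉Y y∈

module _ {n} (G : Graph n) where

  Adj-sym : ∀ {u v} → Adj G u v → Adj G v u
  Adj-sym {u} {v} u~v = trans (Graph.sym G v u) u~v

  Adj-irrefl : ∀ {u v} → Adj G u v → v ≢ u
  Adj-irrefl {u} u~u refl with () ← trans (sym u~u) (Graph.irrefl G u)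

  ∈N[]⇔ : ∀ {J v} → v ∈ N[ G ] J ⇔ (v ∈ J ⊎ ∃ λ u → u ∈ J × Adj G u v)
  ∈N[]⇔ {J} {v} = mk⇔
    (λ v∈ → Equivalence.to (does≡true⇔ inN?) (trans (sym lookup-N[]) (Equivalence.to ∈⇔lookup v∈)))
    (λ h → Equivalence.from ∈⇔lookup (trans lookup-N[] (Equivalence.from (does≡true⇔ inN?) h)))
    where
    inN? : Dec (v ∈ J ⊎ ∃ λ u → u ∈ J × Adj G u v)
    inN? = v ∈? J ⊎-dec any? (λ u → u ∈? J ×-dec Bool._≟_ (adj G u v) true)

    lookup-N[] : lookup (N[ G ] J) v ≡ does inN?
    lookup-N[] with does inN? | lookup∘tabulate (λ v → if inN G J v then inside else outside) v
    ... | true  | eq = eq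
    ... | false | eq = eq

  ∈N[]⁻ : ∀ {J v} → v ∈ N[ G ] J → v ∈ J ⊎ ∃ λ u → u ∈ J × Adj G u v
  ∈N[]⁻ = Equivalence.to ∈N[]⇔

  ∈N[]⁺ : ∀ {J v} → v ∈ J ⊎ (∃ λ u → u ∈ J × Adj G u v) → v ∈ N[ G ] J
  ∈N[]⁺ = Equivalence.from ∈N[]⇔

  N[]-mono : ∀ {J K} → J ⊆ K → N[ G ] J ⊆ N[ G ] K
  N[]-mono J⊆K v∈ with ∈N[]⁻ v∈
  ... | inj₁ v∈J             = ∈N[]⁺ (inj₁ (J⊆K v∈J))
  ... | inj₂ (u , u∈J , u~v) = ∈N[]⁺ (inj₂ (u , J⊆K u∈J , u~v))

  ∈N[⁅⁆]⁺ : ∀ {m v} → Adj G m v → v ∈ N[ G ] ⁅ m ⁆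
  ∈N[⁅⁆]⁺ {m} m~v = ∈N[]⁺ (inj₂ (m , x∈⁅x⁆ m , m~v))

  -- X ⊆ ∁ N[J] says that no vertex of X lies in J or is adjacent to a vertex of J.
  ⊆∁N[]-swap : ∀ {X J} → X ⊆ ∁ (N[ G ] J) → J ⊆ ∁ (N[ G ] X)
  ⊆∁N[]-swap {X} {J} X⊆ {j} j∈J = x∉p⇒x∈∁p (j∉N[X] ∘ ∈N[]⁻)
    where
    j∉N[X] : j ∈ X ⊎ ∃ (λ x → x ∈ X × Adj G x j) → ⊥
    j∉N[X] (inj₁ j∈X)             = x∈∁p⇒x∉p (X⊆ j∈X) (∈N[]⁺ (inj₁ j∈J))
    j∉N[X] (inj₂ (x , x∈X , x~j)) = x∈∁p⇒x∉p (X⊆ x∈X) (∈N[]⁺ (inj₂ (j , j∈J , Adj-sym x~j)))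

  Dominating⇔ : ∀ {X} → Dominating G X ⇔ ∁ (N[ G ] X) ⊆ Subset.⊥
  Dominating⇔ {X} = mk⇔ to from
    where
    to : Dominating G X → ∁ (N[ G ] X) ⊆ Subset.⊥
    to dom {v} v∈ with v ∈? X
    ... | yes v∈X = contradiction (∈N[]⁺ (inj₁ v∈X)) (x∈∁p⇒x∉p v∈)
    ... | no  v∉X = contradiction (∈N[]⁺ (inj₂ (dom v v∉X))) (x∈∁p⇒x∉p v∈)

    from : ∁ (N[ G ] X) ⊆ Subset.⊥ → Dominating G X
    from ∁N⊆⊥ v v∉X with ∈N[]⁻ (x∉∁p⇒x∈p (∉⊥ ∘ ∁N⊆⊥))
    ... | inj₁ v∈X = contradiction v∈X v∉X
    ... | inj₂ dom = dom

  openNbhd : Fin n → Subset n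
  openNbhd v = N[ G ] ⁅ v ⁆ - v

  m∉openNbhd : ∀ m → m ∉ openNbhd m
  m∉openNbhd m m∈ = x∈p-y⇒x≢y (N[ G ] ⁅ m ⁆) m∈ refl

  Adj⇒∈openNbhd : ∀ {m v} → Adj G m v → v ∈ openNbhd m
  Adj⇒∈openNbhd m~v = x∈p∧x≢y⇒x∈p-y (∈N[⁅⁆]⁺ m~v) (Adj-irrefl m~v)

  -- Toggling m leaves N[J] unchanged: if m ∈ J then m is still dominated by its neighbours,
  -- which lie in openNbhd m ⊆ J, and the vertices m dominates are exactly those neighbours.
  N[]-[]≔ : ∀ {m J} → (∃ λ u → Adj G m u) → openNbhd m ⊆ J →
            N[ G ] (J [ m ]≔ inside) ≡ N[ G ] (J [ m ]≔ outside)
  N[]-[]≔ {m} {J} (w , m~w) Nm⊆J = ⊆-antisym in⊆out (N[]-mono ([]≔outside⊆[]≔inside J m))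
    where
    nbr∈J[m]≔outside : ∀ {v} → Adj G m v → v ∈ J [ m ]≔ outside
    nbr∈J[m]≔outside m~v = ∈-[]≔⁺ (Adj-irrefl m~v) (Nm⊆J (Adj⇒∈openNbhd m~v))

    in⊆out : N[ G ] (J [ m ]≔ inside) ⊆ N[ G ] (J [ m ]≔ outside)
    in⊆out {v} v∈ with ∈N[]⁻ v∈
    ... | inj₁ v∈J with v Fin.≟ m
    ...   | yes refl = ∈N[]⁺ (inj₂ (w , nbr∈J[m]≔outside m~w , Adj-sym m~w))
    ...   | no  v≢m  = ∈N[]⁺ (inj₁ (∈-[]≔⁺ v≢m (∈-[]≔⁻ v≢m v∈J)))
    in⊆out {v} v∈ | inj₂ (u , u∈J , u~v) with u Fin.≟ m
    ...   | yes refl = ∈N[]⁺ (inj₁ (nbr∈J[m]≔outside u~v))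
    ...   | no  u≢m  = ∈N[]⁺ (inj₂ (u , ∈-[]≔⁺ u≢m (∈-[]≔⁻ u≢m u∈J) , u~v))

module _ {c ℓ : Level} (R : CommutativeRing c ℓ) where
  open CommutativeRing R hiding (zero) renaming (refl to ≈-refl; sym to ≈-sym; trans to ≈-trans)
  open RingProperties ring using (-1*x≈-x)
  open CommutativeSemigroupProperties +-commutativeSemigroup using (interchange)
  open import Relation.Binary.Reasoning.Setoid setoid

  avoids-↭ : ∀ {𝒳 𝒴 : List (Subset n)} {J} → 𝒳 ↭ 𝒴 → does (avoids? R 𝒳 J) ≡ does (avoids? R 𝒴 J)
  avoids-↭ {𝒳 = 𝒳} {𝒴} {J} 𝒳↭𝒴 =
    does-⇔ (mk⇔ (↭.All-resp-↭ 𝒳↭𝒴) (↭.All-resp-↭ (↭-sym 𝒳↭𝒴))) (avoids? R 𝒳 J) (avoids? R 𝒴 J)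

  avoids-[]≔ : ∀ {m : Fin n} {J s} (𝒳 : List (Subset n)) →
               All (m ∉_) 𝒳 → does (avoids? R 𝒳 (J [ m ]≔ s)) ≡ does (avoids? R 𝒳 J)
  avoids-[]≔ []      []           = refl
  avoids-[]≔ {m = m} {J} {s} (X ∷ 𝒳) (m∉X ∷ m∉𝒳) =
    cong₂ (λ a b → not a ∧ b) (does-⇔ (⊆-[]≔⇔ m∉X) (X ⊆? J [ m ]≔ s) (X ⊆? J)) (avoids-[]≔ 𝒳 m∉𝒳)

  when : Bool → Carrier → Carrier
  when b x = if b then x else 0#

  ∑ₛ : ∀ {n} → (Subset n → Carrier) → Carrier
  ∑ₛ {n} f = sumL R f (allSubsets n)

  if-≈ : ∀ b {x x′ y y′} → x ≈ x′ → y ≈ y′ → (if b then x else y) ≈ (if b then x′ else y′)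
  if-≈ true  x≈x′ _ = x≈x′
  if-≈ false _ y≈y′ = y≈y′

  when-≡ : ∀ {b b′} x → b ≡ b′ → when b x ≈ when b′ x
  when-≡ x refl = ≈-refl

  when-*ˡ : ∀ b k x → when b (k * x) ≈ k * when b x
  when-*ˡ true  k x = ≈-refl
  when-*ˡ false k x = ≈-sym (zeroʳ k)

  when-*ʳ : ∀ b x k → when b (x * k) ≈ when b x * k
  when-*ʳ true  x k = ≈-refl
  when-*ʳ false x k = ≈-sym (zeroˡ k)

  when-1* : ∀ b x → when b 1# * x ≈ when b x
  when-1* true  x = *-identityˡ x
  when-1* false x = zeroˡ x

  when-split : ∀ s a x → when (not s ∧ a) x + when (s ∧ a) x ≈ when a x
  when-split true  a     x = +-identityˡ _
  when-split false true  x = +-identityʳ _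
  when-split false false x = +-identityʳ _

  when-cancel : ∀ b {x y} → (b ≡ true → x + y ≈ 0#) → when b x + when b y ≈ 0#
  when-cancel true  x+y≈0 = x+y≈0 refl
  when-cancel false _     = +-identityʳ 0#

  x+[y-x]≈y : ∀ x y → x + (y + - x) ≈ y
  x+[y-x]≈y x y = begin
    x + (y + - x) ≈⟨ +-congˡ (+-comm y (- x)) ⟩
    x + (- x + y) ≈⟨ +-assoc x (- x) y ⟨
    x + - x + y   ≈⟨ +-congʳ (-‿inverseʳ x) ⟩
    0# + y        ≈⟨ +-identityˡ y ⟩
    y             ∎

  -1*x+x≈0 : ∀ x → - 1# * x + x ≈ 0#
  -1*x+x≈0 x = ≈-trans (+-congʳ (-1*x≈-x x)) (-‿inverseˡ x)

  sumL-cong : ∀ {f g : A → Carrier} xs → (∀ x → f x ≈ g x) → sumL R f xs ≈ sumL R g xs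
  sumL-cong []       f≈g = ≈-refl
  sumL-cong (x ∷ xs) f≈g = +-cong (f≈g x) (sumL-cong xs f≈g)

  sumL-0 : ∀ (xs : List A) → sumL R (λ _ → 0#) xs ≈ 0#
  sumL-0 []       = ≈-refl
  sumL-0 (x ∷ xs) = ≈-trans (+-identityˡ _) (sumL-0 xs)

  sumL-++ : ∀ (f : A → Carrier) xs ys → sumL R f (xs ++ ys) ≈ sumL R f xs + sumL R f ys
  sumL-++ f []       ys = ≈-sym (+-identityˡ _)
  sumL-++ f (x ∷ xs) ys = ≈-trans (+-congˡ (sumL-++ f xs ys)) (≈-sym (+-assoc _ _ _))

  sumL-+ : ∀ (f g : A → Carrier) xs → sumL R (λ x → f x + g x) xs ≈ sumL R f xs + sumL R g xs
  sumL-+ f g []       = ≈-sym (+-identityˡ 0#)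
  sumL-+ f g (x ∷ xs) = ≈-trans (+-congˡ (sumL-+ f g xs)) (interchange _ _ _ _)

  sumL-*ˡ : ∀ k (f : A → Carrier) xs → sumL R (λ x → k * f x) xs ≈ k * sumL R f xs
  sumL-*ˡ k f []       = ≈-sym (zeroʳ k)
  sumL-*ˡ k f (x ∷ xs) = ≈-trans (+-congˡ (sumL-*ˡ k f xs)) (≈-sym (distribˡ k _ _))

  sumL-*ʳ : ∀ k (f : A → Carrier) xs → sumL R (λ x → f x * k) xs ≈ sumL R f xs * k
  sumL-*ʳ k f xs = ≈-trans (sumL-cong xs (λ x → *-comm (f x) k)) (≈-trans (sumL-*ˡ k f xs) (*-comm k _))

  sumL-when-*ˡ : ∀ k (b : A → Bool) (f : A → Carrier) xs →
                 sumL R (λ x → when (b x) (k * f x)) xs ≈ k * sumL R (λ x → when (b x) (f x)) xs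
  sumL-when-*ˡ k b f xs = ≈-trans (sumL-cong xs (λ x → when-*ˡ (b x) k (f x))) (sumL-*ˡ k _ xs)

  sumL-map : ∀ (f : B → Carrier) (g : A → B) xs → sumL R f (map g xs) ≈ sumL R (f ∘ g) xs
  sumL-map f g []       = ≈-refl
  sumL-map f g (x ∷ xs) = +-congˡ (sumL-map f g xs)

  sumL-comm : ∀ (f : A → B → Carrier) xs ys →
              sumL R (λ x → sumL R (f x) ys) xs ≈ sumL R (λ y → sumL R (λ x → f x y) xs) ys
  sumL-comm f []       ys = ≈-sym (sumL-0 ys)
  sumL-comm f (x ∷ xs) ys = ≈-trans (+-congˡ (sumL-comm f xs ys)) (≈-sym (sumL-+ (f x) _ ys))

  ∑ₛ-suc : ∀ {n} (f : Subset (suc n) → Carrier) →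
           ∑ₛ f ≈ ∑ₛ (λ X → f (inside ∷ X)) + ∑ₛ (λ X → f (outside ∷ X))
  ∑ₛ-suc {n} f = ≈-trans (sumL-++ f (map (inside ∷_) (allSubsets n)) (map (outside ∷_) (allSubsets n)))
                         (+-cong (sumL-map f _ (allSubsets n)) (sumL-map f _ (allSubsets n)))

  ∑ₛ-cancel : ∀ {n} (m : Fin n) (f : Subset n → Carrier) →
              (∀ J → f (J [ m ]≔ inside) + f (J [ m ]≔ outside) ≈ 0#) → ∑ₛ f ≈ 0#
  ∑ₛ-cancel {suc n} zero f cancels = begin
    ∑ₛ f
      ≈⟨ ∑ₛ-suc f ⟩
    ∑ₛ (λ X → f (inside ∷ X)) + ∑ₛ (λ X → f (outside ∷ X))
      ≈⟨ sumL-+ (f ∘ (inside ∷_)) (f ∘ (outside ∷_)) (allSubsets n) ⟨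
    ∑ₛ (λ X → f (inside ∷ X) + f (outside ∷ X))
      ≈⟨ sumL-cong (allSubsets n) (λ X → cancels (inside ∷ X)) ⟩
    ∑ₛ {n} (λ _ → 0#)
      ≈⟨ sumL-0 (allSubsets n) ⟩
    0# ∎
  ∑ₛ-cancel {suc n} (suc m) f cancels = begin
    ∑ₛ f
      ≈⟨ ∑ₛ-suc f ⟩
    ∑ₛ (λ X → f (inside ∷ X)) + ∑ₛ (λ X → f (outside ∷ X))
      ≈⟨ +-cong (∑ₛ-cancel m _ (cancels ∘ (inside ∷_))) (∑ₛ-cancel m _ (cancels ∘ (outside ∷_))) ⟩
    0# + 0#
      ≈⟨ +-identityˡ 0# ⟩
    0# ∎

  prodFin-cong : ∀ {n} {f g : Fin n → Carrier} → (∀ v → f v ≈ g v) → prodFin R f ≈ prodFin R g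
  prodFin-cong {zero}  f≈g = ≈-refl
  prodFin-cong {suc n} f≈g = *-cong (f≈g zero) (prodFin-cong (f≈g ∘ suc))

  splitProd : ∀ {n} → (Fin n → Carrier) → (Fin n → Carrier) → Subset n → Carrier
  splitProd a b X = prodFin R (λ v → if does (v ∈? X) then a v else b v)

  splitProd-cong : ∀ {n} {a a′ b b′ : Fin n → Carrier} (X : Subset n) →
                   (∀ v → a v ≈ a′ v) → (∀ v → b v ≈ b′ v) → splitProd a b X ≈ splitProd a′ b′ X
  splitProd-cong X a≈a′ b≈b′ = prodFin-cong (λ v → if-≈ (does (v ∈? X)) (a≈a′ v) (b≈b′ v))

  ∑ₛ-⊆-splitProd : ∀ {n} (C : Subset n) (a b : Fin n → Carrier) →
    ∑ₛ (λ X → when (does (X ⊆? C)) (splitProd a b X)) ≈ splitProd (λ v → a v + b v) b C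
  ∑ₛ-⊆-splitProd {zero} [] a b = +-identityʳ 1#
  ∑ₛ-⊆-splitProd {suc n} (inside ∷ C) a b = begin
    ∑ₛ (λ X → when (does (X ⊆? inside ∷ C)) (splitProd a b X))
      ≈⟨ ∑ₛ-suc (λ X → when (does (X ⊆? inside ∷ C)) (splitProd a b X)) ⟩
    ∑ₛ (λ X → when (does (X ⊆? C)) (a zero * P X)) + ∑ₛ (λ X → when (does (X ⊆? C)) (b zero * P X))
      ≈⟨ +-cong (sumL-when-*ˡ (a zero) _ P (allSubsets n)) (sumL-when-*ˡ (b zero) _ P (allSubsets n)) ⟩
    a zero * S + b zero * S
      ≈⟨ distribʳ S (a zero) (b zero) ⟨
    (a zero + b zero) * S
      ≈⟨ *-congˡ (∑ₛ-⊆-splitProd C (a ∘ suc) (b ∘ suc)) ⟩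
    splitProd (λ v → a v + b v) b (inside ∷ C) ∎
    where
    P : Subset n → Carrier
    P = splitProd (a ∘ suc) (b ∘ suc)
    S : Carrier
    S = ∑ₛ (λ X → when (does (X ⊆? C)) (P X))
  ∑ₛ-⊆-splitProd {suc n} (outside ∷ C) a b = begin
    ∑ₛ (λ X → when (does (X ⊆? outside ∷ C)) (splitProd a b X))
      ≈⟨ ∑ₛ-suc (λ X → when (does (X ⊆? outside ∷ C)) (splitProd a b X)) ⟩
    ∑ₛ {n} (λ _ → 0#) + ∑ₛ (λ X → when (does (X ⊆? C)) (b zero * P X))
      ≈⟨ +-cong (sumL-0 (allSubsets n)) (sumL-when-*ˡ (b zero) _ P (allSubsets n)) ⟩
    0# + b zero * S
      ≈⟨ +-identityˡ _ ⟩
    b zero * S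
      ≈⟨ *-congˡ (∑ₛ-⊆-splitProd C (a ∘ suc) (b ∘ suc)) ⟩
    splitProd (λ v → a v + b v) b (outside ∷ C) ∎
    where
    P : Subset n → Carrier
    P = splitProd (a ∘ suc) (b ∘ suc)
    S : Carrier
    S = ∑ₛ (λ X → when (does (X ⊆? C)) (P X))

  splitProd-sign : ∀ {n} (J : Subset n) → splitProd (λ _ → - 1#) (λ _ → 1#) J ≈ signPow R ∣ J ∣
  splitProd-sign []            = ≈-refl
  splitProd-sign (inside ∷ J)  = *-congˡ (splitProd-sign J)
  splitProd-sign (outside ∷ J) = ≈-trans (*-identityˡ _) (splitProd-sign J)

  splitProd-vanishes : ∀ {n} (B : Subset n) →
    splitProd (λ _ → 0#) (λ _ → 1#) B ≈ when (does (B ⊆? Subset.⊥)) 1#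
  splitProd-vanishes []            = ≈-refl
  splitProd-vanishes (inside ∷ B)  = zeroˡ _
  splitProd-vanishes (outside ∷ B) = ≈-trans (*-identityˡ _) (splitProd-vanishes B)

  -- Both sides are the probability that every vertex of A fails.
  splitProd-q≈∑ₛ : ∀ {n} (p : Fin n → Carrier) (A : Subset n) →
    splitProd (qOf R p) (λ _ → 1#) A ≈ ∑ₛ (λ X → when (does (X ⊆? ∁ A)) (stateProb R p X))
  splitProd-q≈∑ₛ p A = ≈-sym (≈-trans (∑ₛ-⊆-splitProd (∁ A) p (qOf R p)) (prodFin-cong factor))
    where
    factor : ∀ v → (if does (v ∈? ∁ A) then p v + qOf R p v else qOf R p v)
                 ≈ (if does (v ∈? A) then qOf R p v else 1#)
    factor v with does (v ∈? A) | does-⇔ (mk⇔ x∈∁p⇒x∉p x∉p⇒x∈∁p) (v ∈? ∁ A) (¬? (v ∈? A))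
    ... | true  | eq rewrite eq = ≈-refl
    ... | false | eq rewrite eq = x+[y-x]≈y (p v) 1#

  ∑ₛ-⊆-sign : ∀ {n} (B : Subset n) →
    ∑ₛ (λ J → when (does (J ⊆? B)) (signPow R ∣ J ∣)) ≈ when (does (B ⊆? Subset.⊥)) 1#
  ∑ₛ-⊆-sign {n} B = begin
    ∑ₛ (λ J → when (does (J ⊆? B)) (signPow R ∣ J ∣))
      ≈⟨ sumL-cong (allSubsets n) (λ J → if-≈ (does (J ⊆? B)) (splitProd-sign J) ≈-refl) ⟨
    ∑ₛ (λ J → when (does (J ⊆? B)) (splitProd (λ _ → - 1#) (λ _ → 1#) J))
      ≈⟨ ∑ₛ-⊆-splitProd B (λ _ → - 1#) (λ _ → 1#) ⟩
    splitProd (λ _ → - 1# + 1#) (λ _ → 1#) B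
      ≈⟨ splitProd-cong B (λ _ → -‿inverseˡ 1#) (λ _ → ≈-refl) ⟩
    splitProd (λ _ → 0#) (λ _ → 1#) B
      ≈⟨ splitProd-vanishes B ⟩
    when (does (B ⊆? Subset.⊥)) 1# ∎

  module _ {n} (G : Graph n) (p : Fin n → Carrier) where

    incExcTerm-expand : ∀ J → incExcTerm R G p J
      ≈ ∑ₛ (λ X → when (does (J ⊆? ∁ (N[ G ] X))) (signPow R ∣ J ∣ * stateProb R p X))
    incExcTerm-expand J = begin
      incExcTerm R G p J
        ≈⟨ *-congˡ (splitProd-q≈∑ₛ p (N[ G ] J)) ⟩
      signPow R ∣ J ∣ * ∑ₛ (λ X → when (does (X ⊆? ∁ (N[ G ] J))) (stateProb R p X))
        ≈⟨ sumL-when-*ˡ _ _ _ (allSubsets n) ⟨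
      ∑ₛ (λ X → when (does (X ⊆? ∁ (N[ G ] J))) (signPow R ∣ J ∣ * stateProb R p X))
        ≈⟨ sumL-cong (allSubsets n) (λ X → when-≡ (signPow R ∣ J ∣ * stateProb R p X)
                                                (does-⇔ ⊆∁N[]⇔ (X ⊆? ∁ (N[ G ] J)) (J ⊆? ∁ (N[ G ] X)))) ⟩
      ∑ₛ (λ X → when (does (J ⊆? ∁ (N[ G ] X))) (signPow R ∣ J ∣ * stateProb R p X)) ∎
      where
      ⊆∁N[]⇔ : ∀ {X} → X ⊆ ∁ (N[ G ] J) ⇔ J ⊆ ∁ (N[ G ] X)
      ⊆∁N[]⇔ = mk⇔ (⊆∁N[]-swap G) (⊆∁N[]-swap G)

    DRel≈∑incExcTerm : DRel R G p ≈ ∑ₛ (incExcTerm R G p)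
    DRel≈∑incExcTerm = ≈-sym (begin
      ∑ₛ (incExcTerm R G p)
        ≈⟨ sumL-cong (allSubsets n) incExcTerm-expand ⟩
      ∑ₛ (λ J → ∑ₛ (λ X → when (does (J ⊆? ∁N[ X ])) (signPow R ∣ J ∣ * stateProb R p X)))
        ≈⟨ sumL-comm _ (allSubsets n) (allSubsets n) ⟩
      ∑ₛ (λ X → ∑ₛ (λ J → when (does (J ⊆? ∁N[ X ])) (signPow R ∣ J ∣ * stateProb R p X)))
        ≈⟨ sumL-cong (allSubsets n) (λ X → sumL-cong (allSubsets n) (λ J → when-*ʳ (does (J ⊆? ∁N[ X ])) _ _)) ⟩
      ∑ₛ (λ X → ∑ₛ (λ J → when (does (J ⊆? ∁N[ X ])) (signPow R ∣ J ∣) * stateProb R p X))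
        ≈⟨ sumL-cong (allSubsets n) (λ X → sumL-*ʳ _ _ (allSubsets n)) ⟩
      ∑ₛ (λ X → ∑ₛ (λ J → when (does (J ⊆? ∁N[ X ])) (signPow R ∣ J ∣)) * stateProb R p X)
        ≈⟨ sumL-cong (allSubsets n) (λ X → *-congʳ (∑ₛ-⊆-sign ∁N[ X ])) ⟩
      ∑ₛ (λ X → when (does (∁N[ X ] ⊆? Subset.⊥)) 1# * stateProb R p X)
        ≈⟨ sumL-cong (allSubsets n) (λ X → ≈-trans (when-1* _ _) (when-≡ (stateProb R p X) (dominates X))) ⟩
      DRel R G p ∎)
      where
      ∁N[_] : Subset n → Subset n
      ∁N[ X ] = ∁ (N[ G ] X)

      dominates : ∀ X → does (∁N[ X ] ⊆? Subset.⊥) ≡ does (dominating? G X)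
      dominates X = sym (does-⇔ (Dominating⇔ G) (dominating? G X) (∁N[ X ] ⊆? Subset.⊥))

  module _ {n} (G : Graph n) (p : Fin n → Carrier) (noIsolated : NoIsolated G) where

    incExcTerm-[]≔ : ∀ {m J} → openNbhd G m ⊆ J →
      incExcTerm R G p (J [ m ]≔ inside) + incExcTerm R G p (J [ m ]≔ outside) ≈ 0#
    incExcTerm-[]≔ {m} {J} Nm⊆J = begin
      incExcTerm R G p (J [ m ]≔ inside) + incExcTerm R G p (J [ m ]≔ outside)
        ≡⟨ cong₂ (λ k N → signPow R k * Q N + incExcTerm R G p (J [ m ]≔ outside))
                 (∣[]≔inside∣ J m) (N[]-[]≔ G (noIsolated m) Nm⊆J) ⟩
      - 1# * s * q + s * q   ≈⟨ +-congʳ (*-assoc _ _ _) ⟩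
      - 1# * (s * q) + s * q ≈⟨ -1*x+x≈0 _ ⟩
      0#                     ∎
      where
      Q : Subset n → Carrier
      Q = splitProd (qOf R p) (λ _ → 1#)
      s q : Carrier
      s = signPow R ∣ J [ m ]≔ outside ∣
      q = Q (N[ G ] (J [ m ]≔ outside))

    ∑ₛ-avoids : List (Subset n) → Carrier
    ∑ₛ-avoids 𝒳 = ∑ₛ (λ J → when (does (avoids? R 𝒳 J)) (incExcTerm R G p J))

    -- Among the sets J avoiding 𝒴, those containing openNbhd m cancel in pairs J[m]≔inside,
    -- J[m]≔outside; the hypothesis makes the pairing preserve both constraints.
    ∑ₛ-avoids-∷ : ∀ m 𝒴 → All (m ∉_) 𝒴 → ∑ₛ-avoids (openNbhd G m ∷ 𝒴) ≈ ∑ₛ-avoids 𝒴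
    ∑ₛ-avoids-∷ m 𝒴 m∉𝒴 = begin
      ∑ₛ (λ J → when (not (contains J) ∧ avoids J) (t J))
        ≈⟨ +-identityʳ _ ⟨
      ∑ₛ (λ J → when (not (contains J) ∧ avoids J) (t J)) + 0#
        ≈⟨ +-congˡ (∑ₛ-cancel m (λ J → when (contains J ∧ avoids J) (t J)) cancels) ⟨
      ∑ₛ (λ J → when (not (contains J) ∧ avoids J) (t J)) + ∑ₛ (λ J → when (contains J ∧ avoids J) (t J))
        ≈⟨ sumL-+ _ _ (allSubsets n) ⟨
      ∑ₛ (λ J → when (not (contains J) ∧ avoids J) (t J) + when (contains J ∧ avoids J) (t J))
        ≈⟨ sumL-cong (allSubsets n) (λ J → when-split (contains J) (avoids J) (t J)) ⟩
      ∑ₛ-avoids 𝒴 ∎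
      where
      t : Subset n → Carrier
      t = incExcTerm R G p
      contains avoids : Subset n → Bool
      contains J = does (openNbhd G m ⊆? J)
      avoids J = does (avoids? R 𝒴 J)

      constraint-[]≔ : ∀ J s → contains (J [ m ]≔ s) ∧ avoids (J [ m ]≔ s) ≡ contains J ∧ avoids J
      constraint-[]≔ J s = cong₂ _∧_
        (does-⇔ (⊆-[]≔⇔ (m∉openNbhd G m)) (openNbhd G m ⊆? J [ m ]≔ s) (openNbhd G m ⊆? J))
        (avoids-[]≔ 𝒴 m∉𝒴)

      cancels : ∀ J → when (contains (J [ m ]≔ inside) ∧ avoids (J [ m ]≔ inside)) (t (J [ m ]≔ inside))
                    + when (contains (J [ m ]≔ outside) ∧ avoids (J [ m ]≔ outside)) (t (J [ m ]≔ outside)) ≈ 0#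
      cancels J rewrite constraint-[]≔ J inside | constraint-[]≔ J outside =
        when-cancel (contains J ∧ avoids J)
          (λ holds → incExcTerm-[]≔ (proj₁ (Equivalence.to (does≡true⇔ (openNbhd G m ⊆? J ×-dec avoids? R 𝒴 J)) holds)))

    module _ {_≺_ : Rel (Fin n) 0ℓ} (≺-isStrictTotalOrder : IsStrictTotalOrder _≡_ _≺_) where
      open IsStrictTotalOrder ≺-isStrictTotalOrder using (asym; irrefl)
      open NonStrict _≡_ _≺_ using () renaming (_≤_ to _≼_)

      IsMaxOfNbhd : Fin n → Set
      IsMaxOfNbhd v = ∀ u → u ∈ N[ G ] ⁅ v ⁆ → u ≡ v ⊎ u ≺ v

      brokenNbhd-centres : ∀ {𝒳} → All (IsBrokenNbhd G _≺_) 𝒳 →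
                           ∃ λ vs → 𝒳 ≡ map (openNbhd G) vs × All IsMaxOfNbhd vs
      brokenNbhd-centres []                                 = [] , refl , []
      brokenNbhd-centres ((v , v-max , refl) ∷ 𝒳-broken) with brokenNbhd-centres 𝒳-broken
      ... | vs , refl , vs-max = v ∷ vs , refl , v-max ∷ vs-max

      ∉openNbhd-below : ∀ {m w} → IsMaxOfNbhd w → w ≼ m → m ∉ openNbhd G w
      ∉openNbhd-below {m} {w} w-max w≼m m∈ with w-max m (p─q⊆p (N[ G ] ⁅ w ⁆) ⁅ w ⁆ m∈) | w≼m
      ... | inj₁ m≡w | _          = x∈p-y⇒x≢y (N[ G ] ⁅ w ⁆) m∈ m≡w
      ... | inj₂ m≺w | inj₁ w≺m   = asym m≺w w≺m
      ... | inj₂ m≺w | inj₂ refl  = irrefl refl m≺w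

      ≽-decTotalOrder : DecTotalOrder 0ℓ 0ℓ 0ℓ
      ≽-decTotalOrder = Flip.decTotalOrder
        (record { isDecTotalOrder = NonStrict.isDecTotalOrder _≡_ _≺_ ≺-isStrictTotalOrder })

      open import Data.List.Sort ≽-decTotalOrder using (sort; sort-↭; sort-↗)

      ∑ₛ-avoids-descending : ∀ ws → AllPairs (flip _≼_) ws → All IsMaxOfNbhd ws →
                             ∑ₛ-avoids (map (openNbhd G) ws) ≈ ∑ₛ (incExcTerm R G p)
      ∑ₛ-avoids-descending []       []               []               = ≈-refl
      ∑ₛ-avoids-descending (m ∷ ws) (ws≼m ∷ ws-desc) (_ ∷ ws-max) = ≈-trans
        (∑ₛ-avoids-∷ m (map (openNbhd G) ws)
          (All.map⁺ (All.zipWith (λ (w-max , w≼m) → ∉openNbhd-below w-max w≼m) (ws-max , ws≼m))))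
        (∑ₛ-avoids-descending ws ws-desc ws-max)

      ∑ₛ-avoids-broken : ∀ {𝒳} → All (IsBrokenNbhd G _≺_) 𝒳 → ∑ₛ-avoids 𝒳 ≈ ∑ₛ (incExcTerm R G p)
      ∑ₛ-avoids-broken 𝒳-broken with brokenNbhd-centres 𝒳-broken
      ... | vs , refl , vs-max = begin
        ∑ₛ-avoids (map (openNbhd G) vs)
          ≈⟨ sumL-cong (allSubsets n) (λ J → when-≡ (incExcTerm R G p J) (avoids-↭ (↭.map⁺ (openNbhd G) vs↭sorted))) ⟩
        ∑ₛ-avoids (map (openNbhd G) (sort vs))
          ≈⟨ ∑ₛ-avoids-descending (sort vs) (Sorted⇒AllPairs (DecTotalOrder.totalOrder ≽-decTotalOrder) (sort-↗ vs))
                                  (↭.All-resp-↭ vs↭sorted vs-max) ⟩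
        ∑ₛ (incExcTerm R G p) ∎
        where
        vs↭sorted : vs ↭ sort vs
        vs↭sorted = ↭-sym (sort-↭ vs)

theorem4 : ∀ {c ℓ} (R : CommutativeRing c ℓ) {n : ℕ} (G : Graph n) (p : Fin n → CommutativeRing.Carrier R)
    → (CommutativeRing._≈_ R (DRel R G p) (sumL R (incExcTerm R G p) (allSubsets n)))
      × (NoIsolated G → (_≺_ : Rel (Fin n) 0ℓ) → IsStrictTotalOrder _≡_ _≺_
          → (𝒳 : List (Subset n)) → All (IsBrokenNbhd G _≺_) 𝒳
          → CommutativeRing._≈_ R (DRel R G p)
              (sumL R (λ J → if does (avoids? R 𝒳 J) then incExcTerm R G p J else CommutativeRing.0# R) (allSubsets n)))
theorem4 R G p = DRel≈∑incExcTerm R G p , λ noIsolated _ ≺-isStrictTotalOrder _ 𝒳-broken →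
  R.trans (DRel≈∑incExcTerm R G p) (R.sym (∑ₛ-avoids-broken R G p noIsolated ≺-isStrictTotalOrder 𝒳-broken))
  where module R = CommutativeRing R
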